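{- Let $C$ be a single-sorted $<\kappa$-ary clone with an $S$-ary diagonal pair $(d,(e_s)_{s\in S})$. Then $\nu=(\nu_\lambda)_{\lambda<\kappa}$, where $\nu_\lambda:C_\lambda\to\mathrm{H}_\lambda(C_d)$ is given by $\nu_\lambda(f)=\big(e_s\circ f\circ(d\circ(\pi_{(\lambda\times S,(i,t))})_{t\in S})_{i\in\lambda}/\sim\big)_{s\in S}$, is an isomorphism of clones between $C$ and $\mathrm{H}(C_d)$.
   Context: $S$ is a nonzero cardinal (set of smaller ordinals), $\kappa>S$ infinite. A single-sorted $<\kappa$-ary clone $C$ consists of sets $C_\lambda$ ($\lambda<\kappa$; sets of size $<\kappa$ may be arities), projections $\pi_{(\lambda,i)}$ and associative compositions $f\circ(g_i)_i$ with projections as units. An $S$-ary diagonal pair is $(d,(e_s)_{s\in S})$, $d\in C_S$, $e_s\in C_1$, with (1) $e_s\circ d=e_s\circ\pi_{(S,s)}$; (2) $d\circ(e_s\circ\pi_{(S,s)})_{s\in S}=d$; (3) $d\circ(\pi_{(S,0)})_{s\in S}=\pi_{(S,0)}$. An $S$-sorted clone $M$ has sets $M_{(\lambda,v,s)}$, projections $\pi_{(\lambda,v,i)}\in M_{(\lambda,v,v(i))}$ and compositions $M_{(\lambda_1,v_1,s)}\times\prod_iM_{(\lambda_2,v_2,v_1(i))}\to M_{(\lambda_2,v_2,s)}$. $C_d$ is the $S$-sorted clone with $C_{d,(\lambda,v,t)}=\{f\in C_\lambda:e_t\circ f=f\}/\sim$, $f\sim g$ iff $f\circ(e_{v(i)}\circ\pi_{(\lambda,i)})_i=g\circ(e_{v(i)}\circ\pi_{(\lambda,i)})_i$,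 projections $e_{v(i)}\circ\pi_{(\lambda,i)}/\sim$, composition induced from $C$. The homogenization $\mathrm{H}(M)$ of an $S$-sorted clone $M$ is the single-sorted clone with $\mathrm{H}_\lambda(M)=\prod_{s}M_{(\lambda\times S,p_2,s)}$ ($p_2$ second projection), projections $(\pi_{(\lambda\times S,p_2,(i,s))})_s$ and composition $(f_s)_s\circ((g_{i,t})_t)_i=(f_s\circ(g_{i,t})_{(i,t)})_s$. Thus the equivalence $\sim$ in the formula for $\nu_\lambda$ (on $\{f\in C_{\lambda\times S}:e_s\circ f=f\}$) is: $f\sim g$ iff $f\circ(e_t\circ\pi_{(\lambda\times S,(i,t))})_{(i,t)\in\lambda\times S}=g\circ(e_t\circ\pi_{(\lambda\times S,(i,t))})_{(i,t)\in\lambda\times S}$. A clone isomorphism is a family of bijections preserving projections and composition. -}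

module Defs where

open import Level using (0ℓ)
open import Data.Unit using (⊤; tt)
open import Data.Product using (Σ; Σ-syntax; _,_; proj₁; proj₂; _×_)
open import Relation.Binary.Bundles using (Setoid)
open import Function.Structures using (IsBijection)
import Relation.Binary.Reasoning.Setoid as SetoidR

-- Admissible arities ("sets of size < κ").  `Small X` abstracts
-- "|X| < κ"; we only require the closure properties used by the paper's
-- constructions: 1, S and λ × S are arities.

record Arities (S : Set) : Set₁ where
  field
    Small    : Set → Set
    ⊤-small  : Small ⊤
    S-small  : Small S
    ×S-small : ∀ {X} → Small X → Small (X × S)

module _ {S : Set} (A : Arities S) where
  open Arities A

  Ar : Set₁
  Ar = Σ Set Small

  El : Ar → Set
  El = proj₁

  one : Ar
  one = ⊤ , ⊤-small

  Sₐ : Ar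
  Sₐ = S , S-small

  _⊗S : Ar → Ar
  (X , p) ⊗S = (X × S) , ×S-small p

  -- Single-sorted clones (carriers are setoids; for a clone of sets take
  -- propositional equality).

  record RawClone : Set₁ where
    field
      Op   : Ar → Setoid 0ℓ 0ℓ
    ∣_∣ : Ar → Set
    ∣ a ∣ = Setoid.Carrier (Op a)
    Eq : (a : Ar) → ∣ a ∣ → ∣ a ∣ → Set
    Eq a = Setoid._≈_ (Op a)
    field
      π    : (a : Ar) → El a → ∣ a ∣
      comp : ∀ {a b} → ∣ a ∣ → (El a → ∣ b ∣) → ∣ b ∣

  record IsClone (R : RawClone) : Set₁ where
    open RawClone R
    field
      comp-cong : ∀ {a b} {f f' : ∣ a ∣} {g g' : El a → ∣ b ∣} →
                  Eq a f f' → (∀ i → Eq b (g i) (g' i)) →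
                  Eq b (comp f g) (comp f' g')
      assoc     : ∀ {a b c} (f : ∣ a ∣) (g : El a → ∣ b ∣) (h : El b → ∣ c ∣) →
                  Eq c (comp (comp f g) h) (comp f (λ i → comp (g i) h))
      π-left    : ∀ {a b} (i : El a) (g : El a → ∣ b ∣) →
                  Eq b (comp (π a i) g) (g i)
      π-right   : ∀ {a} (f : ∣ a ∣) → Eq a (comp f (π a)) f

  record Clone : Set₁ where
    field
      raw     : RawClone
      isClone : IsClone raw
    open RawClone raw public
    open IsClone isClone public

  -- S-sorted clones: sorts (λ , v , s) with v : λ → S.

  record RawSortedClone : Set₁ where
    field
      Op   : (a : Ar) → (El a → S) → S → Setoid 0ℓ 0ℓ
    Sort : (a : Ar) → (El a → S) → S → Set
    Sort a v s = Setoid.Carrier (Op a v s)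
    field
      π    : (a : Ar) (v : El a → S) (i : El a) → Sort a v (v i)
      comp : ∀ {a₁ v₁ a₂ v₂ s} → Sort a₁ v₁ (s) →
             ((i : El a₁) → Sort a₂ v₂ (v₁ i)) → Sort a₂ v₂ (s)

  H : RawSortedClone → RawClone
  H M = record
    { Op = λ a → record
        { Carrier = (s : S) → M.Sort (a ⊗S) proj₂ s
        ; _≈_ = λ f g → ∀ s → Setoid._≈_ (M.Op (a ⊗S) proj₂ s) (f s) (g s)
        ; isEquivalence = record
            { refl = λ {f} s → Setoid.refl (M.Op (a ⊗S) proj₂ s)
            ; sym = λ p s → Setoid.sym (M.Op (a ⊗S) proj₂ s) (p s)
            ; trans = λ p q s → Setoid.trans (M.Op (a ⊗S) proj₂ s) (p s) (q s) } }
    ; π = λ a i s → M.π (a ⊗S) proj₂ (i , s)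
    ; comp = λ f g s → M.comp (f s) (λ it → g (proj₁ it) (proj₂ it))
    }
    where module M = RawSortedClone M

  record IsCloneIso (R₁ R₂ : RawClone)
      (φ : (a : Ar) → RawClone.∣ R₁ ∣ a → RawClone.∣ R₂ ∣ a) : Set₁ where
    module R₁ = RawClone R₁
    module R₂ = RawClone R₂
    field
      bijective : ∀ a → IsBijection (R₁.Eq a) (R₂.Eq a) (φ a)
      pres-π    : ∀ a i → R₂.Eq a (φ a (R₁.π a i)) (R₂.π a i)
      pres-comp : ∀ {a b} (f : R₁.∣ a ∣) (g : El a → R₁.∣ b ∣) →
                  R₂.Eq b (φ b (R₁.comp f g)) (R₂.comp (φ a f) (λ i → φ b (g i)))

  -- S-ary diagonal pairs.  s₀ plays the role of 0 ∈ S.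

  record DiagonalPair (C : Clone) (s₀ : S) : Set where
    open Clone C
    field
      d     : ∣ Sₐ ∣
      e     : S → ∣ one ∣
      diag₁ : ∀ s → Eq Sₐ (comp (e s) (λ _ → d)) (comp (e s) (λ _ → π Sₐ s))
      diag₂ : Eq Sₐ (comp d (λ s → comp (e s) (λ _ → π Sₐ s))) d
      diag₃ : Eq Sₐ (comp d (λ _ → π Sₐ s₀)) (π Sₐ s₀)

  module _ (C : Clone) {s₀ : S} (D : DiagonalPair C s₀) where
    open Clone C
    open DiagonalPair D

    P : S → ∣ Sₐ ∣
    P t = comp (e t) (λ _ → π Sₐ t)
    key : ∀ s → Eq Sₐ (P s) (comp (e s) (λ _ → P s))
    key s = begin
        P s
      ≈⟨ Setoid.sym (Op Sₐ) (diag₁ s) ⟩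
        comp (e s) (λ _ → d)
      ≈⟨ comp-cong (Setoid.refl (Op one)) (λ _ → Setoid.sym (Op Sₐ) diag₂) ⟩
        comp (e s) (λ _ → comp d P)
      ≈⟨ Setoid.sym (Op Sₐ) (assoc (e s) (λ _ → d) P) ⟩
        comp (comp (e s) (λ _ → d)) P
      ≈⟨ comp-cong (diag₁ s) (λ _ → Setoid.refl (Op Sₐ)) ⟩
        comp (P s) P
      ≈⟨ assoc (e s) (λ _ → π Sₐ s) P ⟩
        comp (e s) (λ _ → comp (π Sₐ s) P)
      ≈⟨ comp-cong (Setoid.refl (Op one)) (λ _ → π-left s P) ⟩
        comp (e s) (λ _ → P s)
      ∎
      where open SetoidR (Op Sₐ)

    e-idem : ∀ s → Eq one (comp (e s) (λ _ → e s)) (e s)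
    e-idem s = begin
        comp (e s) (λ _ → e s)
      ≈⟨ comp-cong (Setoid.refl (Op one)) (λ _ → Setoid.sym (Op one) (π-right (e s))) ⟩
        comp (e s) (λ _ → comp (e s) (π one))
      ≈⟨ comp-cong (Setoid.refl (Op one)) (λ _ → comp-cong (Setoid.refl (Op one)) (λ _ → Setoid.sym (Op one) (π-left s (λ _ → π one tt)))) ⟩
        comp (e s) (λ _ → comp (e s) (λ _ → comp (π Sₐ s) (λ _ → π one tt)))
      ≈⟨ comp-cong (Setoid.refl (Op one)) (λ _ → Setoid.sym (Op one) (assoc (e s) (λ _ → π Sₐ s) (λ _ → π one tt))) ⟩
        comp (e s) (λ _ → comp (comp (e s) (λ _ → π Sₐ s)) (λ _ → π one tt))
      ≈⟨ Setoid.sym (Op one) (assoc (e s) (λ _ → comp (e s) (λ _ → π Sₐ s)) (λ _ → π one tt)) ⟩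
        comp (comp (e s) (λ _ → comp (e s) (λ _ → π Sₐ s))) (λ _ → π one tt)
      ≈⟨ comp-cong (Setoid.sym (Op Sₐ) (key s)) (λ _ → Setoid.refl (Op one)) ⟩
        comp (comp (e s) (λ _ → π Sₐ s)) (λ _ → π one tt)
      ≈⟨ assoc (e s) (λ _ → π Sₐ s) (λ _ → π one tt) ⟩
        comp (e s) (λ _ → comp (π Sₐ s) (λ _ → π one tt))
      ≈⟨ comp-cong (Setoid.refl (Op one)) (λ _ → π-left s (λ _ → π one tt)) ⟩
        comp (e s) (π one)
      ≈⟨ π-right (e s) ⟩
        e s
      ∎
      where
      open SetoidR (Op one)

    e-absorb : ∀ {a} t (f : ∣ a ∣) →
               Eq a (comp (e t) (λ _ → comp (e t) (λ _ → f))) (comp (e t) (λ _ → f))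
    e-absorb {a} t f =
      Setoid.trans (Op a) (Setoid.sym (Op a) (assoc (e t) (λ _ → e t) (λ _ → f)))
        (comp-cong (e-idem t) (λ _ → Setoid.refl (Op a)))

    eπ : (a : Ar) (v : El a → S) (i : El a) → ∣ a ∣
    eπ a v i = comp (e (v i)) (λ _ → π a i)

    Cd : RawSortedClone
    Cd = record
      { Op = λ a v t → record
          { Carrier = Σ[ f ∈ ∣ a ∣ ] Eq a (comp (e t) (λ _ → f)) f
          ; _≈_ = λ x y → Eq a (comp (proj₁ x) (eπ a v)) (comp (proj₁ y) (eπ a v))
          ; isEquivalence = record
              { refl = Setoid.refl (Op a)
              ; sym = Setoid.sym (Op a)
              ; trans = Setoid.trans (Op a) } }
      ; π = λ a v i → eπ a v i , e-absorb (v i) (π a i)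
      ; comp = λ {a₁} {v₁} {a₂} {v₂} {s} x g →
          comp (proj₁ x) (λ i → proj₁ (g i)) ,
          Setoid.trans (Op a₂)
            (Setoid.sym (Op a₂) (assoc (e s) (λ _ → proj₁ x) (λ i → proj₁ (g i))))
            (comp-cong (proj₂ x) (λ _ → Setoid.refl (Op a₂)))
      }

    ν-rep : (a : Ar) → ∣ a ∣ → S → ∣ a ⊗S ∣
    ν-rep a f s =
      comp (e s) (λ _ → comp f (λ i → comp d (λ t → π (a ⊗S) (i , t))))

    ν : (a : Ar) → ∣ a ∣ → RawClone.∣ H Cd ∣ a
    ν a f s = ν-rep a f s , e-absorb s (comp f (λ i → comp d (λ t → π (a ⊗S) (i , t))))

-- The inverse of ν sends (h_s)_s to d ∘ (h_s ∘ (e_t ∘ π_(λ,i))_(i,t))_s: the diagonal d glues the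
-- S components back into one operation. Every identity needed then follows from three consequences
-- of the diagonal-pair axioms, e_s ∘ (d ∘ x) = e_s ∘ x_s, d ∘ (e_s ∘ x_s)_s = d ∘ x and
-- d ∘ (y)_s = y: the first lets e_s select the s-th component of a d-combination, the last two let
-- d reassemble an operation from its components.
module Submission where

open import Defs
open import Data.Product using (_,_; proj₁; proj₂)
open import Function.Base using (const)
open import Function.Bundles using (Bijection)
open import Function.Definitions using (Congruent; StrictlyInverseˡ; StrictlyInverseʳ)
open import Function.Structures using (IsBijection)
open import Function.Properties.Inverse using (Inverse⇒Bijection)
open import Function.Consequences.Setoid using (strictlyInverseˡ⇒inverseˡ; strictlyInverseʳ⇒inverseʳ)
open import Relation.Binary.Bundles using (Setoid)
import Relation.Binary.Reasoning.Setoid as SetoidReasoning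

isBijection-fromInverse :
  ∀ {a b ℓ₁ ℓ₂} (X : Setoid a ℓ₁) (Y : Setoid b ℓ₂)
  (f : Setoid.Carrier X → Setoid.Carrier Y) (g : Setoid.Carrier Y → Setoid.Carrier X) →
  Congruent (Setoid._≈_ X) (Setoid._≈_ Y) f → Congruent (Setoid._≈_ Y) (Setoid._≈_ X) g →
  StrictlyInverseˡ (Setoid._≈_ Y) f g → StrictlyInverseʳ (Setoid._≈_ X) f g →
  IsBijection (Setoid._≈_ X) (Setoid._≈_ Y) f
isBijection-fromInverse X Y f g f-cong g-cong f∘g≈id g∘f≈id =
  Bijection.isBijection (Inverse⇒Bijection {S = X} {T = Y} record
    { to        = f
    ; from      = g
    ; to-cong   = f-cong
    ; from-cong = g-cong
    ; inverse   = strictlyInverseˡ⇒inverseˡ X Y f-cong f∘g≈id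
                , strictlyInverseʳ⇒inverseʳ X Y g-cong g∘f≈id
    })

module CloneProperties {S : Set} {A : Arities S} (C : Clone A) where
  open Clone C public

  infixl 5 _⊙_
  _⊙_ : ∀ {a b} → ∣ a ∣ → (El A a → ∣ b ∣) → ∣ b ∣
  _⊙_ = comp

  infix 4 _≈_
  _≈_ : ∀ {a} → ∣ a ∣ → ∣ a ∣ → Set
  _≈_ {a} = Eq a

  ≈-refl : ∀ {a} {f : ∣ a ∣} → f ≈ f
  ≈-refl {a} = Setoid.refl (Op a)

  comp-congˡ : ∀ {a b} {f f' : ∣ a ∣} {g : El A a → ∣ b ∣} → f ≈ f' → f ⊙ g ≈ f' ⊙ g
  comp-congˡ f≈f' = comp-cong f≈f' (λ _ → ≈-refl)

  comp-congʳ : ∀ {a b} {f : ∣ a ∣} {g g' : El A a → ∣ b ∣} →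
               (∀ i → g i ≈ g' i) → f ⊙ g ≈ f ⊙ g'
  comp-congʳ = comp-cong ≈-refl

  assoc₃ : ∀ {a b c d} (f : ∣ a ∣) (g : El A a → ∣ b ∣) (h : El A b → ∣ c ∣)
           (k : El A c → ∣ d ∣) → f ⊙ g ⊙ h ⊙ k ≈ f ⊙ (λ i → g i ⊙ h ⊙ k)
  assoc₃ {d = d} f g h k = begin
    f ⊙ g ⊙ h ⊙ k           ≈⟨ comp-congˡ (assoc f g h) ⟩
    f ⊙ (λ i → g i ⊙ h) ⊙ k ≈⟨ assoc f _ k ⟩
    f ⊙ (λ i → g i ⊙ h ⊙ k) ∎
    where open SetoidReasoning (Op d)

  comp-π-reindex : ∀ {a b c} (f : ∣ a ∣) (r : El A a → El A b) (g : El A b → ∣ c ∣) →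
                   f ⊙ (λ i → π b (r i)) ⊙ g ≈ f ⊙ (λ i → g (r i))
  comp-π-reindex f r g =
    Setoid.trans (Op _) (assoc f _ g) (comp-congʳ (λ i → π-left (r i) g))

module DiagonalPairProperties {S : Set} {A : Arities S} {C : Clone A} {s₀ : S}
                              (D : DiagonalPair A C s₀) where
  open CloneProperties C
  open DiagonalPair D

  e-d-select : ∀ {b} s (x : S → ∣ b ∣) → e s ⊙ const (d ⊙ x) ≈ e s ⊙ const (x s)
  e-d-select {b} s x = begin
    e s ⊙ const (d ⊙ x)            ≈⟨ assoc (e s) (const d) x ⟨
    e s ⊙ const d ⊙ x              ≈⟨ comp-congˡ (diag₁ s) ⟩
    e s ⊙ const (π (Sₐ A) s) ⊙ x   ≈⟨ comp-π-reindex (e s) (const s) x ⟩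
    e s ⊙ const (x s)              ∎
    where open SetoidReasoning (Op b)

  d-e-absorb : ∀ {b} (x : S → ∣ b ∣) → d ⊙ (λ s → e s ⊙ const (x s)) ≈ d ⊙ x
  d-e-absorb {b} x = begin
    d ⊙ (λ s → e s ⊙ const (x s))                        ≈⟨ comp-congʳ (λ s → comp-π-reindex (e s) (const s) x) ⟨
    d ⊙ (λ s → e s ⊙ const (π (Sₐ A) s) ⊙ x)             ≈⟨ assoc d _ x ⟨
    d ⊙ (λ s → e s ⊙ const (π (Sₐ A) s)) ⊙ x             ≈⟨ comp-congˡ diag₂ ⟩
    d ⊙ x                                                ∎
    where open SetoidReasoning (Op b)

  d-const : ∀ {b} (y : ∣ b ∣) → d ⊙ const y ≈ y
  d-const {b} y = begin
    d ⊙ const y                          ≈⟨ comp-π-reindex d (const s₀) (const y) ⟨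
    d ⊙ const (π (Sₐ A) s₀) ⊙ const y    ≈⟨ comp-congˡ diag₃ ⟩
    π (Sₐ A) s₀ ⊙ const y                ≈⟨ π-left s₀ (const y) ⟩
    y                                    ∎
    where open SetoidReasoning (Op b)

  d-e-const : ∀ {b} (y : ∣ b ∣) → d ⊙ (λ s → e s ⊙ const y) ≈ y
  d-e-const y = Setoid.trans (Op _) (d-e-absorb (const y)) (d-const y)

  eπ-idem : ∀ a (v : El A a → S) i → eπ A C D a v i ⊙ eπ A C D a v ≈ eπ A C D a v i
  eπ-idem a v i = begin
    e (v i) ⊙ const (π a i) ⊙ eπ A C D a v    ≈⟨ comp-π-reindex (e (v i)) (const i) _ ⟩
    e (v i) ⊙ const (eπ A C D a v i)          ≈⟨ e-absorb A C D (v i) (π a i) ⟩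
    eπ A C D a v i                            ∎
    where open SetoidReasoning (Op a)

module HomogenizationIso {S : Set} {A : Arities S} {C : Clone A} {s₀ : S}
                         (D : DiagonalPair A C s₀) where
  open CloneProperties C
  open DiagonalPair D
  open DiagonalPairProperties D

  private
    module HC = RawClone (H A (Cd A C D))

  Δ : (a : Ar A) → El A a → ∣ _⊗S A a ∣
  Δ a i = d ⊙ (λ t → π (_⊗S A a) (i , t))

  E : (a : Ar A) → El A (_⊗S A a) → ∣ _⊗S A a ∣
  E a = eπ A C D (_⊗S A a) proj₂

  σ : (a : Ar A) → El A (_⊗S A a) → ∣ a ∣
  σ a (i , _) = π a i

  -- h_s ⊙ E a ⊙ σ a is h_s ∘ (e_t ∘ π_(λ,i))_(i,t); passing through E a makes ν⁻¹ respect ∼.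
  ν⁻¹ : (a : Ar A) → HC.∣ a ∣ → ∣ a ∣
  ν⁻¹ a h = d ⊙ (λ s → proj₁ (h s) ⊙ E a ⊙ σ a)

  Δ-E-σ : ∀ a i → Δ a i ⊙ E a ⊙ σ a ≈ π a i
  Δ-E-σ a i = begin
    Δ a i ⊙ E a ⊙ σ a                    ≈⟨ comp-congˡ (comp-π-reindex d (i ,_) (E a)) ⟩
    d ⊙ (λ t → E a (i , t)) ⊙ σ a        ≈⟨ assoc d _ (σ a) ⟩
    d ⊙ (λ t → E a (i , t) ⊙ σ a)        ≈⟨ comp-congʳ (λ t → comp-π-reindex (e t) (const (i , t)) (σ a)) ⟩
    d ⊙ (λ t → e t ⊙ const (π a i))      ≈⟨ d-e-const (π a i) ⟩
    π a i                                ∎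
    where open SetoidReasoning (Op a)

  E-σ-Δ : ∀ a it → E a it ⊙ σ a ⊙ Δ a ≈ E a it
  E-σ-Δ a (i , t) = begin
    e t ⊙ const (π (_⊗S A a) (i , t)) ⊙ σ a ⊙ Δ a   ≈⟨ comp-congˡ (comp-π-reindex (e t) (const (i , t)) (σ a)) ⟩
    e t ⊙ const (π a i) ⊙ Δ a                      ≈⟨ comp-π-reindex (e t) (const i) (Δ a) ⟩
    e t ⊙ const (Δ a i)                            ≈⟨ e-d-select t _ ⟩
    e t ⊙ const (π (_⊗S A a) (i , t))              ∎
    where open SetoidReasoning (Op (_⊗S A a))

  ν⁻¹∘ν : ∀ a (f : ∣ a ∣) → ν⁻¹ a (ν A C D a f) ≈ f
  ν⁻¹∘ν a f = begin
    d ⊙ (λ s → e s ⊙ const (f ⊙ Δ a) ⊙ E a ⊙ σ a)   ≈⟨ comp-congʳ (λ s → assoc₃ (e s) _ (E a) (σ a)) ⟩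
    d ⊙ (λ s → e s ⊙ const (f ⊙ Δ a ⊙ E a ⊙ σ a))   ≈⟨ comp-congʳ (λ s → comp-congʳ (λ _ → cancel)) ⟩
    d ⊙ (λ s → e s ⊙ const f)                       ≈⟨ d-e-const f ⟩
    f                                               ∎
    where
    open SetoidReasoning (Op a)
    cancel : f ⊙ Δ a ⊙ E a ⊙ σ a ≈ f
    cancel = begin
      f ⊙ Δ a ⊙ E a ⊙ σ a                ≈⟨ assoc₃ f (Δ a) (E a) (σ a) ⟩
      f ⊙ (λ i → Δ a i ⊙ E a ⊙ σ a)      ≈⟨ comp-congʳ (Δ-E-σ a) ⟩
      f ⊙ π a                            ≈⟨ π-right f ⟩
      f                                  ∎

  ν-rep-ν⁻¹ : ∀ a (h : HC.∣ a ∣) s → ν-rep A C D a (ν⁻¹ a h) s ≈ proj₁ (h s) ⊙ E a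
  ν-rep-ν⁻¹ a h s = begin
    e s ⊙ const (d ⊙ k ⊙ Δ a)                          ≈⟨ comp-congʳ (λ _ → assoc d k (Δ a)) ⟩
    e s ⊙ const (d ⊙ (λ r → k r ⊙ Δ a))                ≈⟨ e-d-select s _ ⟩
    e s ⊙ const (hₛ ⊙ E a ⊙ σ a ⊙ Δ a)                 ≈⟨ comp-congʳ (λ _ → assoc₃ hₛ (E a) (σ a) (Δ a)) ⟩
    e s ⊙ const (hₛ ⊙ (λ it → E a it ⊙ σ a ⊙ Δ a))     ≈⟨ comp-congʳ (λ _ → comp-congʳ (E-σ-Δ a)) ⟩
    e s ⊙ const (hₛ ⊙ E a)                             ≈⟨ assoc (e s) (const hₛ) (E a) ⟨
    e s ⊙ const hₛ ⊙ E a                               ≈⟨ comp-congˡ (proj₂ (h s)) ⟩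
    hₛ ⊙ E a                                           ∎
    where
    open SetoidReasoning (Op (_⊗S A a))
    hₛ = proj₁ (h s)
    k : S → ∣ a ∣
    k r = proj₁ (h r) ⊙ E a ⊙ σ a

  ν∘ν⁻¹ : ∀ a (h : HC.∣ a ∣) → HC.Eq a (ν A C D a (ν⁻¹ a h)) h
  ν∘ν⁻¹ a h s = begin
    ν-rep A C D a (ν⁻¹ a h) s ⊙ E a   ≈⟨ comp-congˡ (ν-rep-ν⁻¹ a h s) ⟩
    proj₁ (h s) ⊙ E a ⊙ E a           ≈⟨ assoc (proj₁ (h s)) (E a) (E a) ⟩
    proj₁ (h s) ⊙ (λ it → E a it ⊙ E a) ≈⟨ comp-congʳ (eπ-idem (_⊗S A a) proj₂) ⟩
    proj₁ (h s) ⊙ E a                 ∎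
    where open SetoidReasoning (Op (_⊗S A a))

  ν-cong : ∀ a {f f' : ∣ a ∣} → f ≈ f' → HC.Eq a (ν A C D a f) (ν A C D a f')
  ν-cong a f≈f' s = comp-congˡ (comp-congʳ (λ _ → comp-congˡ f≈f'))

  ν⁻¹-cong : ∀ a {h h' : HC.∣ a ∣} → HC.Eq a h h' → ν⁻¹ a h ≈ ν⁻¹ a h'
  ν⁻¹-cong a h≈h' = comp-congʳ (λ s → comp-congˡ (h≈h' s))

  ν-π : ∀ a i → HC.Eq a (ν A C D a (π a i)) (HC.π a i)
  ν-π a i s = comp-congˡ (begin
    e s ⊙ const (π a i ⊙ Δ a)          ≈⟨ comp-congʳ (λ _ → π-left i (Δ a)) ⟩
    e s ⊙ const (Δ a i)                ≈⟨ e-d-select s _ ⟩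
    e s ⊙ const (π (_⊗S A a) (i , s))  ∎)
    where open SetoidReasoning (Op (_⊗S A a))

  Δ-ν-rep : ∀ {a b} (g : El A a → ∣ b ∣) i →
            Δ a i ⊙ (λ (j , t) → ν-rep A C D b (g j) t) ≈ g i ⊙ Δ b
  Δ-ν-rep g i = Setoid.trans (Op _) (comp-π-reindex d (i ,_) _) (d-e-const _)

  ν-comp : ∀ {a b} (f : ∣ a ∣) (g : El A a → ∣ b ∣) →
           HC.Eq b (ν A C D b (f ⊙ g)) (HC.comp (ν A C D a f) (λ i → ν A C D b (g i)))
  ν-comp {a} {b} f g s = comp-congˡ (begin
    e s ⊙ const (f ⊙ g ⊙ Δ b)                ≈⟨ comp-congʳ (λ _ → assoc f g (Δ b)) ⟩
    e s ⊙ const (f ⊙ (λ i → g i ⊙ Δ b))      ≈⟨ comp-congʳ (λ _ → comp-congʳ (Δ-ν-rep g)) ⟨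
    e s ⊙ const (f ⊙ (λ i → Δ a i ⊙ G))      ≈⟨ comp-congʳ (λ _ → assoc f (Δ a) G) ⟨
    e s ⊙ const (f ⊙ Δ a ⊙ G)                ≈⟨ assoc (e s) _ G ⟨
    e s ⊙ const (f ⊙ Δ a) ⊙ G                ∎)
    where
    open SetoidReasoning (Op (_⊗S A b))
    G : El A (_⊗S A a) → ∣ _⊗S A b ∣
    G (j , t) = ν-rep A C D b (g j) t

proposition6p1 : {S : Set} (A : Arities S) (C : Clone A) (s₀ : S)
    (D : DiagonalPair A C s₀) →
    IsCloneIso A (Clone.raw C) (H A (Cd A C D)) (ν A C D)
proposition6p1 A C s₀ D = record
  { bijective = λ a → isBijection-fromInverse (Clone.Op C a) (RawClone.Op (H A (Cd A C D)) a)
                        (ν A C D a) (ν⁻¹ a) (ν-cong a) (λ {h} {h′} → ν⁻¹-cong a {h} {h′}) (ν∘ν⁻¹ a) (ν⁻¹∘ν a)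
  ; pres-π    = ν-π
  ; pres-comp = ν-comp
  }
  where open HomogenizationIso D
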